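{- If $G$ is a connected graph with $\mathrm{rank}_d(G)=3$, then $G$ is a cograph, i.e., $G$ contains no induced subgraph isomorphic to the path $P_4$ on four vertices.
   Context: All graphs are finite and simple. For a connected graph $G$ with vertices $v_1,\dots,v_n$, $D(G)$ is the $n\times n$ matrix with $(i,j)$-entry the distance $d_G(v_i,v_j)$ (length of a shortest path), and $\mathrm{rank}_d(G)$ is the rank of $D(G)$. -}

module Defs where

open import Data.Nat using (ℕ; zero; suc; _≤_)
open import Data.Fin using (Fin; zero; suc)
open import Data.Bool using (Bool; true; false)
open import Data.Integer using (+_)
open import Data.Rational using (ℚ; 0ℚ; _+_; _*_; _/_)
open import Data.Product using (Σ; ∃; _×_; _,_)
open import Function.Definitions using (Injective)
open import Relation.Binary.PropositionalEquality using (_≡_; _≢_)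
open import Relation.Nullary using (¬_)

record Graph (n : ℕ) : Set where
  field
    adj   : Fin n → Fin n → Bool
    sym   : ∀ u v → adj u v ≡ adj v u
    irrefl : ∀ v → adj v v ≡ false
open Graph public

Adj : ∀ {n} → Graph n → Fin n → Fin n → Set
Adj G u v = adj G u v ≡ true

data Walk {n} (G : Graph n) : Fin n → Fin n → ℕ → Set where
  here : ∀ {v} → Walk G v v zero
  step : ∀ {u w v k} → Adj G u w → Walk G w v k → Walk G u v (suc k)

Connected : ∀ {n} → Graph n → Set
Connected G = ∀ u v → ∃ λ k → Walk G u v k

IsDistance : ∀ {n} → Graph n → (Fin n → Fin n → ℕ) → Set
IsDistance G d = ∀ u v → Walk G u v (d u v) × (∀ k → Walk G u v k → d u v ≤ k)

Matrix : ℕ → ℕ → Set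
Matrix m n = Fin m → Fin n → ℚ

sumFin : ∀ {k} → (Fin k → ℚ) → ℚ
sumFin {zero} f = 0ℚ
sumFin {suc k} f = f zero + sumFin (λ i → f (suc i))

ColumnsIndependent : ∀ {m n k} → Matrix m n → (Fin k → Fin n) → Set
ColumnsIndependent M c =
  ∀ (a : Fin _ → ℚ) → (∀ i → sumFin (λ j → a j * M i (c j)) ≡ 0ℚ) → ∀ j → a j ≡ 0ℚ

HasRank : ∀ {m n} → Matrix m n → ℕ → Set
HasRank {n = n} M r =
  (Σ (Fin r → Fin n) λ c → Injective _≡_ _≡_ c × ColumnsIndependent M c)
  × (∀ (c : Fin (suc r) → Fin n) → Injective _≡_ _≡_ c → ¬ ColumnsIndependent M c)

ℕtoℚ : ℕ → ℚ
ℕtoℚ k = (+ k) / 1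

DistMatrix : ∀ {n} → (Fin n → Fin n → ℕ) → Matrix n n
DistMatrix d i j = ℕtoℚ (d i j)

InducedP4 : ∀ {n} → Graph n → Fin n → Fin n → Fin n → Fin n → Set
InducedP4 G a b c d =
  Adj G a b × Adj G b c × Adj G c d ×
  adj G a c ≡ false × adj G a d ≡ false × adj G b d ≡ false

-- cograph: no induced P4 (adjacency pattern forces the four vertices distinct)
Cograph : ∀ {n} → Graph n → Set
Cograph G = ∀ a b c d → ¬ InducedP4 G a b c d

{-# OPTIONS --safe #-}

-- The vertices of an induced path a–b–c–e span the principal submatrix
-- [[0,1,2,x],[1,0,1,2],[2,1,0,1],[x,2,1,0]] of D(G), where the distance x between
-- the ends is 2 or 3. Both matrices are invertible (determinants −7 and −12), so these
-- four columns of D(G) are linearly independent and rank_d(G) ≥ 4.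

module Submission where

open import Defs
open import Data.Nat using (ℕ; zero; suc; _≤_; s≤s; z≤n)
open import Data.Nat.Properties using (≤-antisym; n≤0⇒n≡0; m≤n⇒m<n∨m≡n)
open import Data.Fin using (Fin; zero; suc; _≟_)
open import Data.Fin.Patterns using (0F; 1F; 2F; 3F)
open import Data.Fin.Properties using (all?)
open import Data.Vec.Functional using (_∷_; [])
open import Data.Bool using (true; false)
open import Data.Integer using (ℤ)
import Data.Integer.Literals as ℤ
import Data.Nat.Literals as ℕ
open import Data.Rational using (ℚ; 0ℚ; 1ℚ; _+_; _*_; _-_; -_; _/_)
open import Data.Rational.Properties as ℚ
  using (+-*-commutativeRing; 1≢0; *-identityˡ; *-zeroˡ; *-zeroʳ; +-identityʳ; +-identityˡ)
open import Data.Rational.Solver using (module +-*-Solver)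
open import Data.Product using (∃; _,_; proj₁; proj₂)
open import Data.Sum using (_⊎_; inj₁; inj₂)
open import Data.Empty using (⊥-elim)
open import Function.Definitions using (Injective)
open import Relation.Binary.PropositionalEquality as ≡
  using (_≡_; _≢_; refl; trans; cong; cong₂; subst; ≢-sym; module ≡-Reasoning)
open import Relation.Nullary using (¬_; yes; no; Dec)
open import Relation.Nullary.Decidable using (from-yes)

open import Algebra.Bundles using (CommutativeRing)
open import Algebra.Properties.Semiring.Sum (CommutativeRing.semiring +-*-commutativeRing)
  using (sum; sum-syntax; ∑-comm; ∑-distrib-+; *-distribˡ-sum; *-distribʳ-sum; sum-cong-≗; sum-replicate-zero)
open import Algebra.Properties.CommutativeSemigroup
  (CommutativeRing.*-commutativeSemigroup +-*-commutativeRing) using (xy∙z≈x∙zy)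

private
  variable
    k m n : ℕ

sumFin≡sum : (f : Fin k → ℚ) → sumFin f ≡ sum f
sumFin≡sum {zero}  f = refl
sumFin≡sum {suc k} f = cong (f zero +_) (sumFin≡sum (λ i → f (suc i)))

identity : Matrix n n
identity zero    zero    = 1ℚ
identity zero    (suc _) = 0ℚ
identity (suc _) zero    = 0ℚ
identity (suc i) (suc j) = identity i j

identity-diagonal : (i : Fin n) → identity i i ≡ 1ℚ
identity-diagonal zero    = refl
identity-diagonal (suc i) = identity-diagonal i

identity-offDiagonal : {i j : Fin n} → i ≢ j → identity i j ≡ 0ℚ
identity-offDiagonal {i = zero}  {zero}  i≢j = ⊥-elim (i≢j refl)
identity-offDiagonal {i = zero}  {suc _} _   = refl
identity-offDiagonal {i = suc _} {zero}  _   = refl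
identity-offDiagonal {i = suc i} {suc j} i≢j = identity-offDiagonal (λ i≡j → i≢j (cong suc i≡j))

∑-identity : (i : Fin n) (f : Fin n → ℚ) → ∑[ l < n ] (identity i l * f l) ≡ f i
∑-identity {suc n} zero f = begin
  1ℚ * f zero + ∑[ l < n ] (0ℚ * f (suc l))  ≡⟨ cong₂ _+_ (*-identityˡ (f zero)) (sum-cong-≗ (λ l → *-zeroˡ (f (suc l)))) ⟩
  f zero + ∑[ l < n ] 0ℚ                     ≡⟨ cong (f zero +_) (sum-replicate-zero n) ⟩
  f zero + 0ℚ                                ≡⟨ +-identityʳ (f zero) ⟩
  f zero                                     ∎
  where open ≡-Reasoning
∑-identity {suc n} (suc i) f = begin
  0ℚ * f zero + ∑[ l < n ] (identity i l * f (suc l))  ≡⟨ cong₂ _+_ (*-zeroˡ (f zero)) (∑-identity i (λ l → f (suc l))) ⟩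
  0ℚ + f (suc i)                                       ≡⟨ +-identityˡ (f (suc i)) ⟩
  f (suc i)                                            ∎
  where open ≡-Reasoning

IsLeftInverse : Matrix k m → Matrix m k → Set
IsLeftInverse {m = m} N M = ∀ j l → ∑[ i < m ] (N j i * M i l) ≡ identity j l

isLeftInverse? : (N : Matrix k m) (M : Matrix m k) → Dec (IsLeftInverse N M)
isLeftInverse? {m = m} N M = all? λ j → all? λ l → ∑[ i < m ] (N j i * M i l) ℚ.≟ identity j l

isLeftInverse-cong : {N : Matrix k m} {M M′ : Matrix m k} →
                     (∀ i l → M i l ≡ M′ i l) → IsLeftInverse N M → IsLeftInverse N M′
isLeftInverse-cong {N = N} M≗M′ inv j l =
  trans (sum-cong-≗ (λ i → cong (N j i *_) (≡.sym (M≗M′ i l)))) (inv j l)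

leftInvertible⇒columnsIndependent :
  {M : Matrix m n} (r : Fin k → Fin m) (c : Fin k → Fin n) (N : Matrix k k) →
  IsLeftInverse N (λ i j → M (r i) (c j)) → ColumnsIndependent M c
leftInvertible⇒columnsIndependent {k = k} {M = M} r c N inv a Ma≡0 j = begin
  a j                                                    ≡⟨ ∑-identity j a ⟨
  ∑[ l < k ] (identity j l * a l)                        ≡⟨ sum-cong-≗ (λ l → cong (_* a l) (inv j l)) ⟨
  ∑[ l < k ] (∑[ i < k ] (N j i * S i l) * a l)          ≡⟨ sum-cong-≗ (λ l → *-distribʳ-sum (a l) (λ i → N j i * S i l)) ⟩
  ∑[ l < k ] ∑[ i < k ] ((N j i * S i l) * a l)          ≡⟨ sum-cong-≗ (λ l → sum-cong-≗ (λ i → xy∙z≈x∙zy (N j i) (S i l) (a l))) ⟩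
  ∑[ l < k ] ∑[ i < k ] (N j i * (a l * S i l))          ≡⟨ ∑-comm (λ l i → N j i * (a l * S i l)) ⟩
  ∑[ i < k ] ∑[ l < k ] (N j i * (a l * S i l))          ≡⟨ sum-cong-≗ (λ i → *-distribˡ-sum (N j i) (λ l → a l * S i l)) ⟨
  ∑[ i < k ] (N j i * ∑[ l < k ] (a l * S i l))          ≡⟨ sum-cong-≗ (λ i → cong (N j i *_) (row≡0 i)) ⟩
  ∑[ i < k ] (N j i * 0ℚ)                                ≡⟨ sum-cong-≗ (λ i → *-zeroʳ (N j i)) ⟩
  ∑[ i < k ] 0ℚ                                          ≡⟨ sum-replicate-zero k ⟩
  0ℚ                                                     ∎
  where
  open ≡-Reasoning
  S : Matrix k k
  S i l = M (r i) (c l)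
  row≡0 : ∀ i → ∑[ l < k ] (a l * S i l) ≡ 0ℚ
  row≡0 i = trans (≡.sym (sumFin≡sum (λ l → a l * S i l))) (Ma≡0 (r i))

columnsIndependent⇒injective : {M : Matrix m n} {c : Fin k → Fin n} →
                               ColumnsIndependent M c → Injective _≡_ _≡_ c
columnsIndependent⇒injective {k = k} {M = M} {c} indep {i} {j} ci≡cj with i ≟ j
... | yes i≡j = i≡j
... | no  i≢j = ⊥-elim (1≢0 (trans (≡.sym aᵢ≡1) (indep a Ma≡0 i)))
  where
  open ≡-Reasoning
  open +-*-Solver

  a : Fin k → ℚ
  a l = identity i l - identity j l

  aᵢ≡1 : a i ≡ 1ℚ
  aᵢ≡1 = cong₂ _-_ (identity-diagonal i) (identity-offDiagonal (λ j≡i → i≢j (≡.sym j≡i)))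

  Ma≡0 : ∀ r → sumFin (λ l → a l * M r (c l)) ≡ 0ℚ
  Ma≡0 r = begin
    sumFin (λ l → a l * f l)                                            ≡⟨ sumFin≡sum (λ l → a l * f l) ⟩
    ∑[ l < k ] (a l * f l)                                              ≡⟨ sum-cong-≗ (λ l → split (identity i l) (identity j l) (f l)) ⟩
    ∑[ l < k ] (identity i l * f l + - 1ℚ * (identity j l * f l))       ≡⟨ ∑-distrib-+ (λ l → identity i l * f l) _ ⟩
    ∑[ l < k ] (identity i l * f l) + ∑[ l < k ] (- 1ℚ * (identity j l * f l))
                                                                        ≡⟨ cong (∑[ l < k ] (identity i l * f l) +_) (*-distribˡ-sum (- 1ℚ) (λ l → identity j l * f l)) ⟨
    ∑[ l < k ] (identity i l * f l) + - 1ℚ * ∑[ l < k ] (identity j l * f l)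
                                                                        ≡⟨ cong₂ (λ x y → x + - 1ℚ * y) (∑-identity i f) (∑-identity j f) ⟩
    f i + - 1ℚ * f j                                                    ≡⟨ cong (λ x → f i + - 1ℚ * M r x) ci≡cj ⟨
    f i + - 1ℚ * f i                                                    ≡⟨ cancel (f i) ⟩
    0ℚ                                                                  ∎
    where
    f : Fin k → ℚ
    f l = M r (c l)
    split : ∀ x y z → (x - y) * z ≡ x * z + - 1ℚ * (y * z)
    split = solve 3 (λ x y z → (x :- y) :* z := x :* z :+ con (- 1ℚ) :* (y :* z)) refl
    cancel : ∀ x → x + - 1ℚ * x ≡ 0ℚ
    cancel = solve 1 (λ x → x :+ con (- 1ℚ) :* x := con 0ℚ) refl

p4Distances : ℕ → Fin 4 → Fin 4 → ℕ
p4Distances x = (0 ∷ 1 ∷ 2 ∷ x ∷ [])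
              ∷ (1 ∷ 0 ∷ 1 ∷ 2 ∷ [])
              ∷ (2 ∷ 1 ∷ 0 ∷ 1 ∷ [])
              ∷ (x ∷ 2 ∷ 1 ∷ 0 ∷ [])
              ∷ []

-- Integer literals are overloaded only here; elsewhere ℕ literals must stay builtin
-- (the ring solver computes with its arity argument).
module P4Inverses where
  open import Agda.Builtin.FromNat using (fromNat)
  open import Data.Unit using (tt)

  instance
    ℕ-number   = ℕ.number
    ℤ-number   = ℤ.number
    ℤ-negative = ℤ.negative

  p4Inverse₂ : Matrix 4 4
  p4Inverse₂ i j = numerators i j / 7
    where
    numerators : Fin 4 → Fin 4 → ℤ
    numerators = (-4 ∷  5 ∷ -2 ∷  3 ∷ [])
               ∷ ( 5 ∷ -8 ∷  6 ∷ -2 ∷ [])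
               ∷ (-2 ∷  6 ∷ -8 ∷  5 ∷ [])
               ∷ ( 3 ∷ -2 ∷  5 ∷ -4 ∷ [])
               ∷ []

  p4Inverse₃ : Matrix 4 4
  p4Inverse₃ i j = numerators i j / 6
    where
    numerators : Fin 4 → Fin 4 → ℤ
    numerators = (-2 ∷  3 ∷  0 ∷  1 ∷ [])
               ∷ ( 3 ∷ -6 ∷  3 ∷  0 ∷ [])
               ∷ ( 0 ∷  3 ∷ -6 ∷  3 ∷ [])
               ∷ ( 1 ∷  0 ∷  3 ∷ -2 ∷ [])
               ∷ []

open P4Inverses

p4Distances-invertible : ∀ {x} → x ≡ 2 ⊎ x ≡ 3 → ∃ λ N → IsLeftInverse N (DistMatrix (p4Distances x))
p4Distances-invertible (inj₁ refl) = p4Inverse₂ , from-yes (isLeftInverse? p4Inverse₂ (DistMatrix (p4Distances 2)))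
p4Distances-invertible (inj₂ refl) = p4Inverse₃ , from-yes (isLeftInverse? p4Inverse₃ (DistMatrix (p4Distances 3)))

true≢false : true ≢ false
true≢false ()

module _ {n} {G : Graph n} where

  adj-sym : ∀ {u v} → Adj G u v → Adj G v u
  adj-sym {u} {v} e = trans (Graph.sym G v u) e

  adj-irrefl : ∀ {v} → ¬ Adj G v v
  adj-irrefl {v} e = true≢false (trans (≡.sym e) (irrefl G v))

  separated⇒≢ : ∀ {w u v} → Adj G w u → adj G w v ≡ false → u ≢ v
  separated⇒≢ e f refl = true≢false (trans (≡.sym e) f)

  walk-snoc : ∀ {u w v k} → Walk G u w k → Adj G w v → Walk G u v (suc k)
  walk-snoc here        e = step e here
  walk-snoc (step e′ w) e = step e′ (walk-snoc w e)

  walk-reverse : ∀ {u v k} → Walk G u v k → Walk G v u k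
  walk-reverse here       = here
  walk-reverse (step e w) = walk-snoc (walk-reverse w) (adj-sym e)

  walk₀⇒≡ : ∀ {u v} → Walk G u v 0 → u ≡ v
  walk₀⇒≡ here = refl

  walk₁⇒adj : ∀ {u v} → Walk G u v 1 → Adj G u v
  walk₁⇒adj (step e here) = e

  module Distance {d : Fin n → Fin n → ℕ} (isDist : IsDistance G d) where

    shortest : ∀ u v → Walk G u v (d u v)
    shortest u v = proj₁ (isDist u v)

    dist≤length : ∀ {u v k} → Walk G u v k → d u v ≤ k
    dist≤length w = proj₂ (isDist _ _) _ w

    dist-sym : ∀ u v → d u v ≡ d v u
    dist-sym u v = ≤-antisym (dist≤length (walk-reverse (shortest v u)))
                             (dist≤length (walk-reverse (shortest u v)))

    dist-refl : ∀ v → d v v ≡ 0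
    dist-refl v = n≤0⇒n≡0 (dist≤length (here {v = v}))

    dist≡0⇒≡ : ∀ {u v} → d u v ≡ 0 → u ≡ v
    dist≡0⇒≡ {u} {v} eq = walk₀⇒≡ (subst (Walk G u v) eq (shortest u v))

    dist≡1⇒adj : ∀ {u v} → d u v ≡ 1 → Adj G u v
    dist≡1⇒adj {u} {v} eq = walk₁⇒adj (subst (Walk G u v) eq (shortest u v))

    adj⇒dist≡1 : ∀ {u v} → Adj G u v → d u v ≡ 1
    adj⇒dist≡1 {u} {v} e with d u v in eq | dist≤length (step e here)
    ... | 0 | _ = ⊥-elim (adj-irrefl (subst (Adj G u) (≡.sym (dist≡0⇒≡ eq)) e))
    ... | 1 | _ = refl
    ... | suc (suc _) | s≤s ()

    nonadj⇒2≤dist : ∀ {u v} → u ≢ v → adj G u v ≡ false → 2 ≤ d u v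
    nonadj⇒2≤dist {u} {v} u≢v f with d u v in eq
    ... | 0           = ⊥-elim (u≢v (dist≡0⇒≡ eq))
    ... | 1           = ⊥-elim (true≢false (trans (≡.sym (dist≡1⇒adj eq)) f))
    ... | suc (suc _) = s≤s (s≤s z≤n)

    module InducedP4Distances {a b c e : Fin n}
      (ab : Adj G a b) (bc : Adj G b c) (ce : Adj G c e)
      (a≁c : adj G a c ≡ false) (a≁e : adj G a e ≡ false) (b≁e : adj G b e ≡ false) where

      dist-a-c : d a c ≡ 2
      dist-a-c = ≤-antisym (dist≤length (step ab (step bc here)))
                           (nonadj⇒2≤dist (≢-sym (separated⇒≢ (adj-sym ce) (trans (Graph.sym G e a) a≁e))) a≁c)

      dist-b-e : d b e ≡ 2
      dist-b-e = ≤-antisym (dist≤length (step bc (step ce here))) (nonadj⇒2≤dist (separated⇒≢ ab a≁e) b≁e)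

      dist-a-e≡2⊎3 : d a e ≡ 2 ⊎ d a e ≡ 3
      dist-a-e≡2⊎3 with m≤n⇒m<n∨m≡n (nonadj⇒2≤dist (separated⇒≢ (adj-sym ab) b≁e) a≁e)
      ... | inj₁ 3≤dist = inj₂ (≤-antisym (dist≤length (step ab (step bc (step ce here)))) 3≤dist)
      ... | inj₂ 2≡dist = inj₁ (≡.sym 2≡dist)

      vertices : Fin 4 → Fin n
      vertices = a ∷ b ∷ c ∷ e ∷ []

      distances : ∀ i j → d (vertices i) (vertices j) ≡ p4Distances (d a e) i j
      distances 0F 0F = dist-refl a
      distances 0F 1F = adj⇒dist≡1 ab
      distances 0F 2F = dist-a-c
      distances 0F 3F = refl
      distances 1F 0F = adj⇒dist≡1 (adj-sym ab)
      distances 1F 1F = dist-refl b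
      distances 1F 2F = adj⇒dist≡1 bc
      distances 1F 3F = dist-b-e
      distances 2F 0F = trans (dist-sym c a) dist-a-c
      distances 2F 1F = adj⇒dist≡1 (adj-sym bc)
      distances 2F 2F = dist-refl c
      distances 2F 3F = adj⇒dist≡1 ce
      distances 3F 0F = dist-sym e a
      distances 3F 1F = trans (dist-sym e b) dist-b-e
      distances 3F 2F = adj⇒dist≡1 (adj-sym ce)
      distances 3F 3F = dist-refl e

      vertices-columnsIndependent : ColumnsIndependent (DistMatrix d) vertices
      vertices-columnsIndependent =
        let (N , N-inverse) = p4Distances-invertible dist-a-e≡2⊎3
        in leftInvertible⇒columnsIndependent {M = DistMatrix d} vertices vertices N
             (isLeftInverse-cong {N = N} {M = DistMatrix (p4Distances (d a e))}
               (λ i j → cong ℕtoℚ (≡.sym (distances i j))) N-inverse)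

lemma5 : ∀ (n : ℕ) (G : Graph n) (d : Fin n → Fin n → ℕ) →
           Connected G → IsDistance G d → HasRank (DistMatrix d) 3 → Cograph G
lemma5 n G d _ isDist (_ , noFourIndependentColumns) a b c e (ab , bc , ce , a≁c , a≁e , b≁e) =
  noFourIndependentColumns vertices
    (columnsIndependent⇒injective {M = DistMatrix d} vertices-columnsIndependent)
    vertices-columnsIndependent
  where
  open Distance isDist
  open InducedP4Distances ab bc ce a≁c a≁e b≁e
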